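{- For labeled terms $A,B$, a finite sequence of variables $S$ and a variable $x$: if $A\to_S B$ and $x\notin \mathrm{FV}(A)$, then $A \to_{S\oplus x} B$.
   Context: Labeled terms: $A ::= x \mid \lambda^a x.A \mid A\,@^a A$ with labels $a$ from a countably infinite set containing a distinguished never-bound label $\star$; in $A\,@^a B$ the label $a$ binds the occurrences of $a$ in $A$. $A[x:=B]$ is substitution capturing neither variables nor labels; $A[a:=\star]$ replaces free occurrences of label $a$ by $\star$; $\mathrm{FV}(A)$ is the set of free variables. For a context $C$, $\mathrm{bPath}(C)$ is the sequence of variables bound above the hole; $S\oplus T$ is concatenation of sequences; a term is away from $S$ if none of its free variables occur in $S$. Reduction: $C[(\lambda^a x.A)\,@^a B]\to_S C[A[a:=\star][x:=B]]$ whenever $(\lambda^a x.A)\,@^a B$ is away from $\mathrm{bPath}(C)\oplus S$. -}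

module Defs where

open import Data.Nat using (ℕ; zero; suc; _+_; _⊔_)
open import Data.Nat.Properties using (_≟_)
open import Data.List using (List; []; _∷_; _++_; [_]; filter; foldr)
open import Data.List.Membership.Propositional using (_∈_; _∉_)
open import Data.Bool using (Bool; true; false; if_then_else_)
open import Relation.Nullary using (¬_; does)
open import Relation.Nullary.Decidable using (⌊_⌋)
import Data.List.Membership.DecPropositional as DecMem

open DecMem _≟_ using (_∈?_)

Var : Set
Var = ℕ

-- Labels: a countably infinite set (ℕ-indexed names) plus the
-- distinguished never-bound label ★.
data Label : Set where
  ★   : Label
  lab : ℕ → Label

data Term : Set where
  var : Var → Term
  lam : Label → Var → Term → Term
  app : Term → Label → Term → Term

private
  eqℕ : ℕ → ℕ → Bool
  eqℕ m n = does (m ≟ n)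

  memℕ : ℕ → List ℕ → Bool
  memℕ m xs = does (m ∈? xs)

  maxL : List ℕ → ℕ
  maxL = foldr _⊔_ 0

fresh : List ℕ → ℕ
fresh xs = suc (foldr _⊔_ 0 xs)

FV : Term → List Var
FV (var x)     = x ∷ []
FV (lam a x A) = filter (λ y → ¬? (y ≟ x)) (FV A)
  where open import Relation.Nullary.Decidable using (¬?)
FV (app A a B) = FV A ++ FV B

allVars : Term → List Var
allVars (var x)     = x ∷ []
allVars (lam a x A) = x ∷ allVars A
allVars (app A a B) = allVars A ++ allVars B

-- free (non-★) label names; in  A @^(lab n) B  the label binds occurrences in A
labName : Label → List ℕ
labName ★       = []
labName (lab n) = n ∷ []

FL : Term → List ℕ
FL (var x)           = []
FL (lam a x A)       = labName a ++ FL A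
FL (app A ★ B)       = FL A ++ FL B
FL (app A (lab n) B) = filter (λ m → ¬? (m ≟ n)) (FL A) ++ FL B
  where open import Relation.Nullary.Decidable using (¬?)

allLabs : Term → List ℕ
allLabs (var x)     = []
allLabs (lam a x A) = labName a ++ allLabs A
allLabs (app A a B) = allLabs A ++ labName a ++ allLabs B

size : Term → ℕ
size (var x)     = 1
size (lam a x A) = suc (size A)
size (app A a B) = suc (size A + size B)

-- naive replacement of free variable y by z (capture-free when z does not occur)
renV : Var → Var → Term → Term
renV y z (var w)     = if eqℕ w y then var z else var w
renV y z (lam a w A) = if eqℕ w y then lam a w A else lam a w (renV y z A)
renV y z (app A a B) = app (renV y z A) a (renV y z B)

renLab : ℕ → ℕ → Label → Label
renLab m c ★       = ★
renLab m c (lab n) = if eqℕ n m then lab c else lab n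

renL : ℕ → ℕ → Term → Term
renL m c (var x)           = var x
renL m c (lam a x A)       = lam (renLab m c a) x (renL m c A)
renL m c (app A ★ B)       = app (renL m c A) ★ (renL m c B)
renL m c (app A (lab n) B) =
  if eqℕ n m then app A (lab n) (renL m c B)
             else app (renL m c A) (lab n) (renL m c B)

toStar : Label → Label → Label
toStar ★       b       = b
toStar (lab m) ★       = ★
toStar (lab m) (lab n) = if eqℕ n m then ★ else lab n

_[_:=★] : Term → Label → Term
var x [ a :=★]           = var x
lam b x A [ a :=★]       = lam (toStar a b) x (A [ a :=★])
app A ★ B [ a :=★]       = app (A [ a :=★]) ★ (B [ a :=★])
app A (lab n) B [ ★ :=★] = app A (lab n) B
app A (lab n) B [ lab m :=★] =
  if eqℕ n m then app A (lab n) (B [ lab m :=★])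
             else app (A [ lab m :=★]) (lab n) (B [ lab m :=★])

-- capture-avoiding substitution A[x:=B] (renaming bound variables and bound
-- labels when needed), by recursion on a fuel argument ≥ size A
substF : ℕ → Term → Var → Term → Term
substF zero    A x B = A
substF (suc k) (var y) x B = if eqℕ y x then B else var y
substF (suc k) (lam a y A) x B =
  if eqℕ y x then lam a y A
  else if memℕ y (FV B)
    then (let z = fresh (x ∷ FV B ++ allVars A) in
          lam a z (substF k (renV y z A) x B))
    else lam a y (substF k A x B)
substF (suc k) (app A ★ C) x B = app (substF k A x B) ★ (substF k C x B)
substF (suc k) (app A (lab n) C) x B =
  if memℕ n (FL B)
    then (let c = fresh (FL B ++ allLabs A) in
          app (substF k (renL n c A) x B) (lab c) (substF k C x B))
    else app (substF k A x B) (lab n) (substF k C x B)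

_[_:=_] : Term → Var → Term → Term
A [ x := B ] = substF (size A) A x B

data Ctx : Set where
  hole : Ctx
  lamC : Label → Var → Ctx → Ctx
  appL : Ctx → Label → Term → Ctx
  appR : Term → Label → Ctx → Ctx

plug : Ctx → Term → Term
plug hole         T = T
plug (lamC a x C) T = lam a x (plug C T)
plug (appL C a B) T = app (plug C T) a B
plug (appR A a C) T = app A a (plug C T)

bPath : Ctx → List Var
bPath hole         = []
bPath (lamC a x C) = x ∷ bPath C
bPath (appL C a B) = bPath C
bPath (appR A a C) = bPath C

AwayFrom : Term → List Var → Set
AwayFrom T S = ∀ y → y ∈ FV T → y ∉ S

data _⟶[_]_ : Term → List Var → Term → Set where
  β : ∀ {S} (C : Ctx) (a : Label) (x : Var) (A B : Term) →
      AwayFrom (app (lam a x A) a B) (bPath C ++ S) →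
      plug C (app (lam a x A) a B) ⟶[ S ] plug C ((A [ a :=★]) [ x := B ])

module Submission where

open import Defs
open import Data.List using (List; _++_; [_])
open import Data.List.Properties using (++-assoc)
open import Data.List.Membership.Propositional using (_∈_; _∉_)
open import Data.List.Membership.Propositional.Properties using (∈-++⁺ˡ; ∈-++⁺ʳ; ∈-++⁻; ∈-filter⁺)
open import Data.List.Relation.Unary.Any using (here; there)
open import Data.Sum using (inj₁; inj₂)
open import Data.Nat.Properties using (_≟_)
open import Function using (_∘_)
open import Relation.Nullary.Decidable using (¬?)
open import Relation.Binary.PropositionalEquality using (refl; subst)

FV-plug⁺ : ∀ (C : Ctx) {T y} → y ∈ FV T → y ∉ bPath C → y ∈ FV (plug C T)
FV-plug⁺ hole         y∈ y∉ = y∈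
FV-plug⁺ (lamC a x C) y∈ y∉ =
  ∈-filter⁺ (λ z → ¬? (z ≟ x)) (FV-plug⁺ C y∈ (y∉ ∘ there)) (y∉ ∘ here)
FV-plug⁺ (appL C a B) y∈ y∉ = ∈-++⁺ˡ (FV-plug⁺ C y∈ y∉)
FV-plug⁺ (appR A a C) y∈ y∉ = ∈-++⁺ʳ (FV A) (FV-plug⁺ C y∈ y∉)

AwayFrom-++ : ∀ T S S′ → AwayFrom T S → AwayFrom T S′ → AwayFrom T (S ++ S′)
AwayFrom-++ T S S′ away away′ y y∈ y∈S++S′ with ∈-++⁻ S y∈S++S′
... | inj₁ y∈S  = away y y∈ y∈S
... | inj₂ y∈S′ = away′ y y∈ y∈S′

AwayFrom-singleton : ∀ T x → x ∉ FV T → AwayFrom T [ x ]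
AwayFrom-singleton T x x∉ y y∈ (here refl) = x∉ y∈

mainTheorem4 : (A B : Term) (S : List Var) (x : Var) →
    A ⟶[ S ] B → x ∉ FV A → A ⟶[ S ++ [ x ] ] B
mainTheorem4 _ _ S x (β C a y A B away) x∉ =
  β C a y A B (subst (AwayFrom redex) (++-assoc (bPath C) S [ x ]) away′)
  where
  redex : Term
  redex = app (lam a y A) a B

  -- A variable free in the redex is not bound above the hole, so it stays free in the whole term.
  x∉redex : x ∉ FV redex
  x∉redex x∈ = x∉ (FV-plug⁺ C x∈ (away x x∈ ∘ ∈-++⁺ˡ))

  away′ : AwayFrom redex ((bPath C ++ S) ++ [ x ])
  away′ = AwayFrom-++ redex (bPath C ++ S) [ x ] away (AwayFrom-singleton redex x x∉redex)
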